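{- For any positive integer $n$, \[ \sum_{S\subseteq\{0,\dots,n-1\}}|S-S| = 2^n(2n-7)+O\big(n\,6^{n/3}\big), \] where the implied constant is absolute.
   Context: $S-S=\{s_1-s_2: s_1,s_2\in S\}$; the sum runs over all $2^n$ subsets $S$, including the empty set (for which $|S-S|=0$). -}

module Defs where

open import Data.Nat using (ℕ; zero; suc; _+_)
open import Data.Integer as ℤ using (ℤ; _⊖_)
open import Data.Fin using (Fin; toℕ)
open import Data.Fin.Subset using (Subset; inside; outside; _∈_)
open import Data.Fin.Subset.Properties using (_∈?_)
open import Data.Vec using (_∷_; []; map)
open import Data.List using (List; []; _∷_; _++_; length; deduplicate; concatMap; filter; allFin)
import Data.List as L
open import Data.Nat.ListAction using (sum)

allSubsets : (n : ℕ) → List (Subset n)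
allSubsets zero = [] ∷ []
allSubsets (suc n) = L.map (inside ∷_) (allSubsets n) ++ L.map (outside ∷_) (allSubsets n)

elems : {n : ℕ} → Subset n → List ℕ
elems {n} S = L.map toℕ (filter (_∈? S) (allFin n))

diffList : {n : ℕ} → Subset n → List ℤ
diffList S = concatMap (λ a → L.map (λ b → a ⊖ b) (elems S)) (elems S)

diffCard : {n : ℕ} → Subset n → ℕ
diffCard S = length (deduplicate ℤ._≟_ (diffList S))

totalDiff : ℕ → ℕ
totalDiff n = sum (L.map diffCard (allSubsets n))

{-# OPTIONS --safe #-}
module Submission where

-- Write N_d(n) for the number of S ⊆ {0,…,n-1} with d ∉ S - S.  Since S - S is symmetric and
-- contains 0 iff S ≠ ∅, summing |S - S| over all S gives 2^n (2n - 1) + 1 - 2 Σ_{d<n} N_d(n).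
-- Let n = 2K + e with e ≤ 1.  For d = K + e + i with i < K the constraints "not both j and j + d"
-- involve disjoint pairs, so N_d(n) = 3^(K-i) 2^(e+2i) exactly; these terms sum to
-- 3·2^n - 2^e 3^(K+1), which turns the main term into 2^n (2n - 7) and leaves the error
-- 1 + 2^(e+1) 3^(K+1) - 2 Σ_{d<K+e} N_d(n).  Both parts are O(n 6^(n/3)): 27^K ≤ 36^K, and for
-- 1 ≤ d ≤ n/2 cutting off 2d points multiplies N_d by at most N_d(2d) = 3^d ≤ 6^(2d/3), until
-- m < 2d points remain, where N_d(m) ≤ 2^m, or N_d(m) is known exactly if m > d.  All estimates
-- are carried out on cubes, in ℕ.

open import Defs
open import Data.Nat using (ℕ; _≤_; _*_; _^_)
open import Data.Integer using (+_; ∣_∣) renaming (_*_ to _*ℤ_; _-_ to _-ℤ_)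
open import Data.Product using (∃-syntax)

open import Data.Bool using (Bool; true; false; not; _∧_; _∨_; T)
open import Data.Bool.Properties using (T-∧; T-∨; T-≡; ∨-identityʳ)
open import Data.Fin using (Fin; toℕ; fromℕ<)
open import Data.Fin.Properties using (toℕ-fromℕ<)
open import Data.Fin.Subset using (Subset)
import Data.Fin.Subset.Properties as Subset
open import Data.Integer using (ℤ; -[1+_]; _⊖_)
import Data.Integer as ℤ
import Data.Integer.Properties as ℤ
open import Data.Integer.Tactic.RingSolver using () renaming (solve-∀ to ℤ-solve-∀)
open import Data.List as L using (List; []; _∷_; _++_; applyUpTo)
open import Data.List.Properties using (map-++; map-cong; map-∘)
open import Data.List.Membership.Propositional using (_∈_; _∉_; find; lose)
open import Data.List.Membership.Propositional.Properties
  using (∈-map⁺; ∈-map⁻; ∈-filter⁺; ∈-filter⁻; ∈-allFin; ∈-concatMap⁺; ∈-concatMap⁻;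
         ∈-deduplicate⁺; ∈-deduplicate⁻; ∈-++⁺ˡ; ∈-++⁺ʳ; ∈-upTo⁺)
open import Data.List.Relation.Unary.Any using (here; there)
import Data.List.Relation.Unary.All as All
open import Data.List.Relation.Unary.AllPairs using (_∷_)
open import Data.List.Relation.Unary.Unique.Propositional using (Unique)
import Data.List.Relation.Unary.Unique.Propositional.Properties as Unique
open import Data.List.Relation.Unary.Unique.DecPropositional.Properties using (deduplicate-!)
open import Data.Nat using (zero; suc; _+_; _<_; _∸_; z≤n; s≤s; _≤?_; _<?_; NonZero)
open import Data.Nat.Induction using (<-rec)
open import Data.Nat.ListAction using (sum)
open import Data.Nat.ListAction.Properties using (sum-++)
open import Data.Nat.Properties
open import Algebra.Properties.CommutativeSemigroup +-commutativeSemigroup using (interchange)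
open import Algebra.Properties.CommutativeSemigroup *-commutativeSemigroup
  using () renaming (interchange to *-interchange; x∙yz≈y∙xz to *-left-comm)
open import Data.Nat.Solver using (module +-*-Solver)
open import Data.Nat.Tactic.RingSolver using (solve-∀)
open import Data.Product using (_×_; _,_; proj₂)
open import Data.Sum using (_⊎_; inj₁; inj₂)
open import Data.Vec using (Vec; []; _∷_)
import Data.Vec as V
open import Data.Vec.Properties using ([]=⇒lookup; lookup⇒[]=)
open import Function using (_∘_)
open import Function.Bundles using (Equivalence; _⇔_; mk⇔)
open import Induction.WellFounded using (WfRec)
open import Relation.Binary.Definitions using (DecidableEquality)
open import Relation.Binary.PropositionalEquality
open import Relation.Nullary using (¬_; Dec; contradiction; yes; no)
open import Relation.Nullary.Decidable using (T?; does; does-⇔; dec-true; dec-false)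

open Equivalence using (to; from)

∑ : {A : Set} → List A → (A → ℕ) → ℕ
∑ xs f = sum (L.map f xs)

infix 7 ∑
syntax ∑ xs (λ x → e) = ∑[ x ∈ xs ] e

∑< : ℕ → (ℕ → ℕ) → ℕ
∑< zero    f = 0
∑< (suc n) f = f 0 + ∑< n (f ∘ suc)

infix 7 ∑<
syntax ∑< n (λ i → e) = ∑[ i < n ] e

module _ {A : Set} where

  ∑-++ : ∀ (xs ys : List A) f → ∑ (xs ++ ys) f ≡ ∑ xs f + ∑ ys f
  ∑-++ xs ys f = trans (cong sum (map-++ f xs ys)) (sum-++ (L.map f xs) (L.map f ys))

  ∑-cong : ∀ (xs : List A) {f g} → (∀ x → f x ≡ g x) → ∑ xs f ≡ ∑ xs g
  ∑-cong xs f≗g = cong sum (map-cong f≗g xs)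

  ∑-mono : ∀ (xs : List A) {f g} → (∀ x → f x ≤ g x) → ∑ xs f ≤ ∑ xs g
  ∑-mono []       f≤g = z≤n
  ∑-mono (x ∷ xs) f≤g = +-mono-≤ (f≤g x) (∑-mono xs f≤g)

  ∑-zero : ∀ (xs : List A) → ∑[ x ∈ xs ] 0 ≡ 0
  ∑-zero []       = refl
  ∑-zero (x ∷ xs) = ∑-zero xs

  ∑-+ : ∀ (xs : List A) f g → ∑[ x ∈ xs ] (f x + g x) ≡ ∑ xs f + ∑ xs g
  ∑-+ []       f g = refl
  ∑-+ (x ∷ xs) f g =
    trans (cong (_+_ (f x + g x)) (∑-+ xs f g)) (interchange (f x) (g x) (∑ xs f) (∑ xs g))

  ∑-*ˡ : ∀ (xs : List A) c f → ∑[ x ∈ xs ] (c * f x) ≡ c * ∑ xs f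
  ∑-*ˡ []       c f = sym (*-zeroʳ c)
  ∑-*ˡ (x ∷ xs) c f = trans (cong (_+_ (c * f x)) (∑-*ˡ xs c f)) (sym (*-distribˡ-+ c (f x) _))

  ∑-*ʳ : ∀ (xs : List A) f c → ∑[ x ∈ xs ] (f x * c) ≡ ∑ xs f * c
  ∑-*ʳ xs f c = trans (∑-cong xs λ x → *-comm (f x) c) (trans (∑-*ˡ xs c f) (*-comm c (∑ xs f)))

  ∑-∑<-comm : ∀ (xs : List A) n (f : A → ℕ → ℕ) →
    ∑[ x ∈ xs ] ∑< n (f x) ≡ ∑[ i < n ] ∑[ x ∈ xs ] f x i
  ∑-∑<-comm xs zero    f = ∑-zero xs
  ∑-∑<-comm xs (suc n) f =
    trans (∑-+ xs (λ x → f x 0) _) (cong (_+_ (∑[ x ∈ xs ] f x 0)) (∑-∑<-comm xs n (λ x → f x ∘ suc)))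

∑-map : ∀ {A B : Set} (g : A → B) xs f → ∑ (L.map g xs) f ≡ ∑ xs (f ∘ g)
∑-map g xs f = cong sum (sym (map-∘ xs))

∑-applyUpTo : ∀ {A : Set} (g : ℕ → A) n f → ∑ (applyUpTo g n) f ≡ ∑< n (f ∘ g)
∑-applyUpTo g zero    f = refl
∑-applyUpTo g (suc n) f = cong (_+_ (f (g 0))) (∑-applyUpTo (g ∘ suc) n f)

∑<-cong : ∀ n {f g} → (∀ i → i < n → f i ≡ g i) → ∑< n f ≡ ∑< n g
∑<-cong zero    f≗g = refl
∑<-cong (suc n) f≗g = cong₂ _+_ (f≗g 0 (s≤s z≤n)) (∑<-cong n (λ i i<n → f≗g (suc i) (s≤s i<n)))

∑<-+ : ∀ n f g → ∑[ i < n ] (f i + g i) ≡ ∑< n f + ∑< n g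
∑<-+ zero    f g = refl
∑<-+ (suc n) f g =
  trans (cong (_+_ (f 0 + g 0)) (∑<-+ n (f ∘ suc) (g ∘ suc))) (interchange (f 0) (g 0) _ _)

∑<-*ˡ : ∀ n c f → ∑[ i < n ] (c * f i) ≡ c * ∑< n f
∑<-*ˡ zero    c f = sym (*-zeroʳ c)
∑<-*ˡ (suc n) c f = trans (cong (_+_ (c * f 0)) (∑<-*ˡ n c (f ∘ suc))) (sym (*-distribˡ-+ c (f 0) _))

∑<-const : ∀ n c → ∑[ i < n ] c ≡ n * c
∑<-const zero    c = refl
∑<-const (suc n) c = cong (_+_ c) (∑<-const n c)

∑<-+-split : ∀ a b f → ∑< (a + b) f ≡ ∑< a f + ∑[ i < b ] f (a + i)
∑<-+-split zero    b f = refl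
∑<-+-split (suc a) b f = trans (cong (_+_ (f 0)) (∑<-+-split a b (f ∘ suc))) (sym (+-assoc (f 0) _ _))

∑<-suc : ∀ n f → ∑< (suc n) f ≡ ∑< n f + f n
∑<-suc n f = begin
  ∑< (suc n) f               ≡⟨ cong (λ m → ∑< m f) (+-comm 1 n) ⟩
  ∑< (n + 1) f               ≡⟨ ∑<-+-split n 1 f ⟩
  ∑< n f + (f (n + 0) + 0)   ≡⟨ cong (_+_ (∑< n f)) (trans (+-identityʳ _) (cong f (+-identityʳ n))) ⟩
  ∑< n f + f n               ∎
  where open ≡-Reasoning

∑-geometric : ∀ a K → ∑[ i < K ] (a ^ (K ∸ i) * suc a ^ i) + a ^ suc K ≡ a * suc a ^ K
∑-geometric a zero    = refl
∑-geometric a (suc K) = begin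
  (a ^ suc K * 1 + ∑[ i < K ] (a ^ (K ∸ i) * (suc a * suc a ^ i))) + a * a ^ suc K
    ≡⟨ cong (λ s → (a ^ suc K * 1 + s) + a * a ^ suc K)
         (trans (∑<-cong K λ i _ → *-left-comm (a ^ (K ∸ i)) (suc a) (suc a ^ i)) (∑<-*ˡ K (suc a) _)) ⟩
  (a ^ suc K * 1 + suc a * G) + a * a ^ suc K
    ≡⟨ regroup (a ^ suc K) a G ⟩
  suc a * (G + a ^ suc K)
    ≡⟨ cong (suc a *_) (∑-geometric a K) ⟩
  suc a * (a * suc a ^ K)
    ≡⟨ *-left-comm (suc a) a (suc a ^ K) ⟩
  a * suc a ^ suc K ∎
  where
  open ≡-Reasoning
  G : ℕ
  G = ∑[ i < K ] (a ^ (K ∸ i) * suc a ^ i)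
  regroup : ∀ t a g → (t * 1 + suc a * g) + a * t ≡ suc a * (g + t)
  regroup = solve-∀

T-⇔⇒≡ : ∀ {x y} → T x ⇔ T y → x ≡ y
T-⇔⇒≡ {x} {y} x⇔y = does-⇔ x⇔y (T? x) (T? y)

¬T⇒≡false : ∀ {x} → ¬ T x → x ≡ false
¬T⇒≡false {x} = dec-false (T? x)

𝟙[_] : Bool → ℕ
𝟙[ true  ] = 1
𝟙[ false ] = 0

𝟙≤1 : ∀ b → 𝟙[ b ] ≤ 1
𝟙≤1 true  = ≤-refl
𝟙≤1 false = z≤n

𝟙+𝟙-not : ∀ b → 𝟙[ b ] + 𝟙[ not b ] ≡ 1
𝟙+𝟙-not true  = refl
𝟙+𝟙-not false = refl

𝟙-not-∨-≤ : ∀ x y z → 𝟙[ not (x ∨ (y ∨ z)) ] ≤ 𝟙[ not x ] * 𝟙[ not z ]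
𝟙-not-∨-≤ true  y     z     = z≤n
𝟙-not-∨-≤ false true  z     = z≤n
𝟙-not-∨-≤ false false true  = z≤n
𝟙-not-∨-≤ false false false = ≤-refl

module _ {A : Set} (_≟_ : DecidableEquality A) where

  open import Data.List.Membership.DecPropositional _≟_ using (_∈?_)

  ∑-𝟙-≟-∉ : ∀ R y → y ∉ R → ∑[ z ∈ R ] 𝟙[ does (z ≟ y) ] ≡ 0
  ∑-𝟙-≟-∉ []      y y∉R = refl
  ∑-𝟙-≟-∉ (r ∷ R) y y∉R =
    cong₂ _+_ (cong 𝟙[_] (dec-false (r ≟ y) λ r≡y → y∉R (here (sym r≡y)))) (∑-𝟙-≟-∉ R y (y∉R ∘ there))

  ∑-𝟙-≟-unique : ∀ R y → Unique R → y ∈ R → ∑[ z ∈ R ] 𝟙[ does (z ≟ y) ] ≡ 1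
  ∑-𝟙-≟-unique (r ∷ R) y (r∉R ∷ _) (here refl) =
    cong₂ _+_ (cong 𝟙[_] (dec-true (r ≟ r) refl)) (∑-𝟙-≟-∉ R r λ r∈R → All.lookup r∉R r∈R refl)
  ∑-𝟙-≟-unique (r ∷ R) y (r∉R ∷ !R) (there y∈R) =
    cong₂ _+_ (cong 𝟙[_] (dec-false (r ≟ y) (All.lookup r∉R y∈R))) (∑-𝟙-≟-unique R y !R y∈R)

  𝟙-does-∨ : ∀ {P Q : Set} (p : Dec P) (q : Dec Q) → (P → ¬ Q) →
    𝟙[ does p ∨ does q ] ≡ 𝟙[ does p ] + 𝟙[ does q ]
  𝟙-does-∨ (no _)  q       _    = refl
  𝟙-does-∨ (yes _) (no _)  _    = refl
  𝟙-does-∨ (yes p) (yes q) P⇒¬Q = contradiction q (P⇒¬Q p)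

  length-unique-⊆ : ∀ (R ys : List A) → Unique R → Unique ys → (∀ {z} → z ∈ ys → z ∈ R) →
    L.length ys ≡ ∑[ z ∈ R ] 𝟙[ does (z ∈? ys) ]
  length-unique-⊆ R []       !R _           _    = sym (∑-zero R)
  length-unique-⊆ R (y ∷ ys) !R (y∉ys ∷ !ys) ys⊆R = sym (begin
    ∑[ z ∈ R ] 𝟙[ does (z ≟ y) ∨ does (z ∈? ys) ]
      ≡⟨ (∑-cong R λ z → 𝟙-does-∨ (z ≟ y) (z ∈? ys) λ { refl y∈ys → All.lookup y∉ys y∈ys refl }) ⟩
    ∑[ z ∈ R ] (𝟙[ does (z ≟ y) ] + 𝟙[ does (z ∈? ys) ])
      ≡⟨ ∑-+ R _ _ ⟩
    ∑[ z ∈ R ] 𝟙[ does (z ≟ y) ] + ∑[ z ∈ R ] 𝟙[ does (z ∈? ys) ]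
      ≡⟨ cong₂ _+_ (∑-𝟙-≟-unique R y !R (ys⊆R (here refl)))
                   (sym (length-unique-⊆ R ys !R !ys (ys⊆R ∘ there))) ⟩
    suc (L.length ys) ∎)
    where open ≡-Reasoning

  length-deduplicate : ∀ (R xs : List A) → Unique R → (∀ {z} → z ∈ xs → z ∈ R) →
    L.length (L.deduplicate _≟_ xs) ≡ ∑[ z ∈ R ] 𝟙[ does (z ∈? xs) ]
  length-deduplicate R xs !R xs⊆R = begin
    L.length (L.deduplicate _≟_ xs)
      ≡⟨ length-unique-⊆ R (L.deduplicate _≟_ xs) !R (deduplicate-! _≟_ xs) (xs⊆R ∘ ∈-deduplicate⁻ _≟_ xs) ⟩
    ∑[ z ∈ R ] 𝟙[ does (z ∈? L.deduplicate _≟_ xs) ]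
      ≡⟨ (∑-cong R λ z → cong 𝟙[_] (does-⇔ dedup⇔ (z ∈? _) (z ∈? xs))) ⟩
    ∑[ z ∈ R ] 𝟙[ does (z ∈? xs) ] ∎
    where
    open ≡-Reasoning
    dedup⇔ : ∀ {z} → z ∈ L.deduplicate _≟_ xs ⇔ z ∈ xs
    dedup⇔ = mk⇔ (∈-deduplicate⁻ _≟_ xs) (∈-deduplicate⁺ _≟_)

-- Powers and cube roots

^-distribʳ-* : ∀ m n k → (m * n) ^ k ≡ m ^ k * n ^ k
^-distribʳ-* m n zero    = refl
^-distribʳ-* m n (suc k) =
  trans (cong ((m * n) *_) (^-distribʳ-* m n k)) (*-interchange m n (m ^ k) (n ^ k))

3^≤4^ : ∀ k → 3 ^ k ≤ 2 ^ k * 2 ^ k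
3^≤4^ k = subst (3 ^ k ≤_) (^-distribʳ-* 2 2 k) (^-monoˡ-≤ k (s≤s (s≤s (s≤s z≤n))))

cube-3^≤6^ : ∀ c → (3 ^ c) ^ 3 ≤ 6 ^ (c + c)
cube-3^≤6^ c = begin
  (3 ^ c) ^ 3                       ≡⟨ solve 1 (λ x → x :^ 3 := (x :* x) :* x) refl (3 ^ c) ⟩
  (3 ^ c * 3 ^ c) * 3 ^ c           ≤⟨ *-monoʳ-≤ (3 ^ c * 3 ^ c) (3^≤4^ c) ⟩
  (3 ^ c * 3 ^ c) * (2 ^ c * 2 ^ c) ≡⟨ regroup (3 ^ c) (2 ^ c) ⟩
  (2 ^ c * 3 ^ c) * (2 ^ c * 3 ^ c) ≡⟨ cong₂ _*_ (^-distribʳ-* 2 3 c) (^-distribʳ-* 2 3 c) ⟨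
  6 ^ c * 6 ^ c                     ≡⟨ ^-distribˡ-+-* 6 c c ⟨
  6 ^ (c + c)                       ∎
  where
  open ≤-Reasoning
  open +-*-Solver
  regroup : ∀ x y → (x * x) * (y * y) ≡ (y * x) * (y * x)
  regroup = solve-∀

cube-3^*-≤6^ : ∀ d m x → x ^ 3 ≤ 6 ^ m → (3 ^ d * x) ^ 3 ≤ 6 ^ (d + (d + m))
cube-3^*-≤6^ d m x x³≤6^m = begin
  (3 ^ d * x) ^ 3        ≡⟨ ^-distribʳ-* (3 ^ d) x 3 ⟩
  (3 ^ d) ^ 3 * x ^ 3    ≤⟨ *-mono-≤ (cube-3^≤6^ d) x³≤6^m ⟩
  6 ^ (d + d) * 6 ^ m    ≡⟨ ^-distribˡ-+-* 6 (d + d) m ⟨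
  6 ^ (d + d + m)        ≡⟨ cong (6 ^_) (+-assoc d d m) ⟩
  6 ^ (d + (d + m))      ∎
  where open ≤-Reasoning

cube-3^*2^≤6^ : ∀ {a b} → b ≤ a → (3 ^ a * 2 ^ b) ^ 3 ≤ 6 ^ (a + (a + b))
cube-3^*2^≤6^ {b = b} b≤a with m≤n⇒∃[o]m+o≡n b≤a
... | c , refl = begin
  (3 ^ (b + c) * 2 ^ b) ^ 3       ≡⟨ cong (_^ 3) 3^[b+c]*2^b≡3^c*6^b ⟩
  (3 ^ c * 6 ^ b) ^ 3             ≤⟨ cube-3^*-≤6^ c (b * 3) (6 ^ b) (≤-reflexive (^-*-assoc 6 b 3)) ⟩
  6 ^ (c + (c + b * 3))           ≡⟨ cong (6 ^_) (exponents b c) ⟩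
  6 ^ ((b + c) + ((b + c) + b))   ∎
  where
  open ≤-Reasoning
  regroup : ∀ x y z → x * y * z ≡ y * (z * x)
  regroup = solve-∀
  3^[b+c]*2^b≡3^c*6^b : 3 ^ (b + c) * 2 ^ b ≡ 3 ^ c * 6 ^ b
  3^[b+c]*2^b≡3^c*6^b = begin-equality
    3 ^ (b + c) * 2 ^ b       ≡⟨ cong (_* 2 ^ b) (^-distribˡ-+-* 3 b c) ⟩
    3 ^ b * 3 ^ c * 2 ^ b     ≡⟨ regroup (3 ^ b) (3 ^ c) (2 ^ b) ⟩
    3 ^ c * (2 ^ b * 3 ^ b)   ≡⟨ cong (3 ^ c *_) (^-distribʳ-* 2 3 b) ⟨
    3 ^ c * 6 ^ b             ∎
  exponents : ∀ b c → c + (c + b * 3) ≡ (b + c) + ((b + c) + b)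
  exponents = solve-∀

^-cancelˡ-≤ : ∀ n .{{_ : NonZero n}} {x y} → x ^ n ≤ y ^ n → x ≤ y
^-cancelˡ-≤ n {x} {y} xⁿ≤yⁿ with x ≤? y
... | yes x≤y = x≤y
... | no  x≰y = contradiction xⁿ≤yⁿ (<⇒≱ (^-monoˡ-< n (≰⇒> x≰y)))

infix 4 _≤_·∛_

-- x ≤ α · ∛Z, stated with both sides cubed.
record _≤_·∛_ (x α Z : ℕ) : Set where
  constructor mk·∛
  field cubed : x ^ 3 ≤ α ^ 3 * Z

open _≤_·∛_ using (cubed)

module _ {Z : ℕ} where

  ·∛-1 : ∀ {a} → a ^ 3 ≤ Z → a ≤ 1 ·∛ Z
  ·∛-1 a³≤Z = mk·∛ (≤-trans a³≤Z (≤-reflexive (sym (*-identityˡ Z))))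

  ·∛-monoˡ : ∀ {a b α} → a ≤ b → b ≤ α ·∛ Z → a ≤ α ·∛ Z
  ·∛-monoˡ a≤b (mk·∛ b≤) = mk·∛ (≤-trans (^-monoˡ-≤ 3 a≤b) b≤)

  ·∛-monoʳ : ∀ {a α β} → α ≤ β → a ≤ α ·∛ Z → a ≤ β ·∛ Z
  ·∛-monoʳ α≤β (mk·∛ a≤) = mk·∛ (≤-trans a≤ (*-monoˡ-≤ Z (^-monoˡ-≤ 3 α≤β)))

  ·∛-*ˡ : ∀ c {a α} → a ≤ α ·∛ Z → c * a ≤ c * α ·∛ Z
  ·∛-*ˡ c {a} {α} (mk·∛ a≤) = mk·∛ (begin
    (c * a) ^ 3         ≡⟨ ^-distribʳ-* c a 3 ⟩
    c ^ 3 * a ^ 3       ≤⟨ *-monoʳ-≤ (c ^ 3) a≤ ⟩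
    c ^ 3 * (α ^ 3 * Z) ≡⟨ *-assoc (c ^ 3) (α ^ 3) Z ⟨
    c ^ 3 * α ^ 3 * Z   ≡⟨ cong (_* Z) (^-distribʳ-* c α 3) ⟨
    (c * α) ^ 3 * Z     ∎)
    where open ≤-Reasoning

  ·∛-+ : ∀ {a b α β} → a ≤ α ·∛ Z → b ≤ β ·∛ Z → a + b ≤ α + β ·∛ Z
  ·∛-+ {a} {b} {α} {β} a≤ b≤ = mk·∛ (begin
    (a + b) ^ 3
      ≡⟨ solve 2 (λ a b → (a :+ b) :^ 3 := a :^ 3 :+ con 3 :* (a :* a :* b)
                                                   :+ con 3 :* (b :* b :* a) :+ b :^ 3)
               refl a b ⟩
    a ^ 3 + 3 * (a * a * b) + 3 * (b * b * a) + b ^ 3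
      ≤⟨ +-mono-≤ (+-mono-≤ (+-mono-≤ (cubed a≤) (*-monoʳ-≤ 3 (mixed a≤ b≤)))
                            (*-monoʳ-≤ 3 (mixed b≤ a≤)))
                  (cubed b≤) ⟩
    α ^ 3 * Z + 3 * (α * α * β * Z) + 3 * (β * β * α * Z) + β ^ 3 * Z
      ≡⟨ solve 3 (λ α β Z → (α :+ β) :^ 3 :* Z := α :^ 3 :* Z :+ con 3 :* (α :* α :* β :* Z)
                                                 :+ con 3 :* (β :* β :* α :* Z) :+ β :^ 3 :* Z)
               refl α β Z ⟨
    (α + β) ^ 3 * Z ∎)
    where
    open ≤-Reasoning
    open +-*-Solver
    mixed : ∀ {x y ξ η} → x ≤ ξ ·∛ Z → y ≤ η ·∛ Z → x * x * y ≤ ξ * ξ * η * Z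
    mixed {x} {y} {ξ} {η} (mk·∛ x≤) (mk·∛ y≤) = ^-cancelˡ-≤ 3 (begin
      (x * x * y) ^ 3
        ≡⟨ solve 2 (λ x y → (x :* x :* y) :^ 3 := x :^ 3 :* x :^ 3 :* y :^ 3) refl x y ⟩
      x ^ 3 * x ^ 3 * y ^ 3
        ≤⟨ *-mono-≤ (*-mono-≤ x≤ x≤) y≤ ⟩
      (ξ ^ 3 * Z) * (ξ ^ 3 * Z) * (η ^ 3 * Z)
        ≡⟨ solve 3 (λ ξ η Z → (ξ :^ 3 :* Z) :* (ξ :^ 3 :* Z) :* (η :^ 3 :* Z) := (ξ :* ξ :* η :* Z) :^ 3)
                 refl ξ η Z ⟩
      (ξ * ξ * η * Z) ^ 3 ∎)

  ·∛-∑< : ∀ m f → (∀ i → i < m → f i ≤ 1 ·∛ Z) → ∑< m f ≤ m ·∛ Z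
  ·∛-∑< zero    f f≤ = mk·∛ z≤n
  ·∛-∑< (suc m) f f≤ = ·∛-+ (f≤ 0 (s≤s z≤n)) (·∛-∑< m (f ∘ suc) λ i i<m → f≤ (suc i) (s≤s i<m))

⊖-view : ∀ a b → (∃[ d ] a ≡ b + d × a ⊖ b ≡ + d) ⊎ (∃[ d ] b ≡ a + suc d × a ⊖ b ≡ -[1+ d ])
⊖-view zero    zero    = inj₁ (0 , refl , refl)
⊖-view (suc a) zero    = inj₁ (suc a , refl , refl)
⊖-view zero    (suc b) = inj₂ (b , refl , refl)
⊖-view (suc a) (suc b) with ⊖-view a b
... | inj₁ (d , a≡b+d , a-b≡d)   = inj₁ (d , cong suc a≡b+d , trans (ℤ.[1+m]⊖[1+n]≡m⊖n a b) a-b≡d)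
... | inj₂ (d , b≡a+1+d , a-b≡-d) = inj₂ (d , cong suc b≡a+1+d , trans (ℤ.[1+m]⊖[1+n]≡m⊖n a b) a-b≡-d)

[m+n]⊖m≡+n : ∀ m n → (m + n) ⊖ m ≡ + n
[m+n]⊖m≡+n m n = trans (cong ((m + n) ⊖_) (sym (+-identityʳ m))) (ℤ.+-cancelˡ-⊖ m n 0)

m⊖[m+1+n]≡-[1+n] : ∀ m n → m ⊖ (m + suc n) ≡ -[1+ n ]
m⊖[m+1+n]≡-[1+n] m n = trans (cong (_⊖ (m + suc n)) (sym (+-identityʳ m))) (ℤ.+-cancelˡ-⊖ m 0 (suc n))

∣m⊖n∣≤m+n : ∀ m n → ∣ m ⊖ n ∣ ≤ m + n
∣m⊖n∣≤m+n m n = ≤-trans (ℤ.∣m⊝n∣≤m⊔n m n) (m⊔n≤m+n m n)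

[+t]-[+p]*[+m-+c]≡x⊖b : ∀ t p m c b x → b + (t + p * c) ≡ p * m + x →
  + t -ℤ + p *ℤ (+ m -ℤ + c) ≡ x ⊖ b
[+t]-[+p]*[+m-+c]≡x⊖b t p m c b x eq = begin
  + t -ℤ + p *ℤ (+ m -ℤ + c)          ≡⟨ regroup (+ t) (+ p) (+ m) (+ c) ⟩
  (+ t ℤ.+ + p *ℤ + c) -ℤ + p *ℤ + m  ≡⟨ cong₂ _-ℤ_ (trans (ℤ.pos-+ t (p * c))
                                                             (cong (ℤ._+_ (+ t)) (ℤ.pos-* p c)))
                                                      (ℤ.pos-* p m) ⟨
  + (t + p * c) -ℤ + (p * m)           ≡⟨ ℤ.[+m]-[+n]≡m⊖n (t + p * c) (p * m) ⟩
  (t + p * c) ⊖ (p * m)                ≡⟨ ℤ.+-cancelˡ-⊖ b (t + p * c) (p * m) ⟨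
  (b + (t + p * c)) ⊖ (b + p * m)      ≡⟨ cong₂ _⊖_ eq (+-comm b (p * m)) ⟩
  (p * m + x) ⊖ (p * m + b)            ≡⟨ ℤ.+-cancelˡ-⊖ (p * m) x b ⟩
  x ⊖ b                                ∎
  where
  open ≡-Reasoning
  regroup : ∀ t p m c → t -ℤ p *ℤ (m -ℤ c) ≡ (t ℤ.+ p *ℤ c) -ℤ p *ℤ m
  regroup = ℤ-solve-∀

-- Subsets as Boolean vectors

at : ∀ {n} → Vec Bool n → ℕ → Bool
at []      k       = false
at (b ∷ S) zero    = b
at (b ∷ S) (suc k) = at S k

at-< : ∀ {n} (S : Vec Bool n) k → T (at S k) → k < n
at-< (b ∷ S) zero    _ = s≤s z≤n
at-< (b ∷ S) (suc k) p = s≤s (at-< S k p)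

at-++ˡ : ∀ {a b} (A : Vec Bool a) (B : Vec Bool b) {j} → j < a → at (A V.++ B) j ≡ at A j
at-++ˡ (x ∷ A) B {zero}  _         = refl
at-++ˡ (x ∷ A) B {suc j} (s≤s j<a) = at-++ˡ A B j<a

at-++ʳ : ∀ {a b} (A : Vec Bool a) (B : Vec Bool b) i → at (A V.++ B) (a + i) ≡ at B i
at-++ʳ []      B i = refl
at-++ʳ (x ∷ A) B i = at-++ʳ A B i

HasDiff : ∀ {n} → Vec Bool n → ℕ → Set
HasDiff S d = ∃[ j ] T (at S j) × T (at S (j + d))

hasDiff : ∀ {n} → Vec Bool n → ℕ → Bool
hasDiff []      d = false
hasDiff (b ∷ S) d = (b ∧ at (b ∷ S) d) ∨ hasDiff S d

hasDiff-sound : ∀ {n} (S : Vec Bool n) d → T (hasDiff S d) → HasDiff S d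
hasDiff-sound (b ∷ S) d p with to T-∨ p
... | inj₁ q = 0 , to T-∧ q
... | inj₂ q with hasDiff-sound S d q
...   | j , u , v = suc j , u , v

hasDiff-complete : ∀ {n} (S : Vec Bool n) d → HasDiff S d → T (hasDiff S d)
hasDiff-complete (b ∷ S) d (zero  , u , v) = from T-∨ (inj₁ (from T-∧ (u , v)))
hasDiff-complete (b ∷ S) d (suc j , u , v) = from T-∨ (inj₂ (hasDiff-complete S d (j , u , v)))

hasDiff-≥ : ∀ {m} (S : Vec Bool m) d → m ≤ d → hasDiff S d ≡ false
hasDiff-≥ {m} S d m≤d = ¬T⇒≡false λ p →
  let (j , _ , v) = hasDiff-sound S d p in <⇒≱ (at-< S (j + d) v) (≤-trans m≤d (m≤n+m d j))

Meets : ∀ {a b} → Vec Bool a → Vec Bool b → Set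
Meets A B = ∃[ j ] T (at A j) × T (at B j)

meets : ∀ {a b} → Vec Bool a → Vec Bool b → Bool
meets []      B       = false
meets (x ∷ A) []      = false
meets (x ∷ A) (y ∷ B) = (x ∧ y) ∨ meets A B

meets-sound : ∀ {a b} (A : Vec Bool a) (B : Vec Bool b) → T (meets A B) → Meets A B
meets-sound (x ∷ A) (y ∷ B) p with to T-∨ p
... | inj₁ q = 0 , to T-∧ q
... | inj₂ q with meets-sound A B q
...   | j , u , v = suc j , u , v

meets-complete : ∀ {a b} (A : Vec Bool a) (B : Vec Bool b) → Meets A B → T (meets A B)
meets-complete (x ∷ A) (y ∷ B) (zero  , u , v) = from T-∨ (inj₁ (from T-∧ (u , v)))
meets-complete (x ∷ A) (y ∷ B) (suc j , u , v) = from T-∨ (inj₂ (meets-complete A B (j , u , v)))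

meets-[]ʳ : ∀ {a} (A : Vec Bool a) → meets A [] ≡ false
meets-[]ʳ []      = refl
meets-[]ʳ (x ∷ A) = refl

meets-++ʳ : ∀ {a c} (A B : Vec Bool a) (C : Vec Bool c) → meets A (B V.++ C) ≡ meets A B
meets-++ʳ []      []      C = refl
meets-++ʳ (x ∷ A) (y ∷ B) C = cong (_∨_ (x ∧ y)) (meets-++ʳ A B C)

hasDiff-++ : ∀ {d m} (A : Vec Bool d) (B : Vec Bool m) →
  hasDiff (A V.++ B) d ≡ meets A B ∨ hasDiff B d
hasDiff-++ {d} A B = T-⇔⇒≡ (mk⇔ split join)
  where
  inB : ∀ i → at (A V.++ B) (d + i) ≡ at B i
  inB = at-++ʳ A B

  inB+d : ∀ i → at (A V.++ B) ((d + i) + d) ≡ at B (i + d)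
  inB+d i = trans (cong (at (A V.++ B)) (+-assoc d i d)) (inB (i + d))

  split : T (hasDiff (A V.++ B) d) → T (meets A B ∨ hasDiff B d)
  split p with hasDiff-sound (A V.++ B) d p
  ... | j , u , v with j <? d
  ...   | yes j<d = from T-∨ (inj₁ (meets-complete A B
                      (j , subst T (at-++ˡ A B j<d) u ,
                           subst T (trans (cong (at (A V.++ B)) (+-comm j d)) (inB j)) v)))
  ...   | no j≮d with m≤n⇒∃[o]m+o≡n (≮⇒≥ j≮d)
  ...     | i , refl = from T-∨ (inj₂ (hasDiff-complete B d (i , subst T (inB i) u , subst T (inB+d i) v)))

  join : T (meets A B ∨ hasDiff B d) → T (hasDiff (A V.++ B) d)
  join p with to T-∨ p
  ... | inj₁ q with meets-sound A B q
  ...   | j , u , v = hasDiff-complete (A V.++ B) d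
                        (j , subst T (sym (at-++ˡ A B (at-< A j u))) u ,
                             subst T (trans (sym (inB j)) (cong (at (A V.++ B)) (+-comm d j))) v)
  join p | inj₂ q with hasDiff-sound B d q
  ...   | i , u , v =
    hasDiff-complete (A V.++ B) d (d + i , subst T (sym (inB i)) u , subst T (sym (inB+d i)) v)

∑-allSubsets-suc : ∀ n f →
  ∑ (allSubsets (suc n)) f ≡ ∑[ S ∈ allSubsets n ] f (true ∷ S) + ∑[ S ∈ allSubsets n ] f (false ∷ S)
∑-allSubsets-suc n f = trans (∑-++ (L.map (true ∷_) (allSubsets n)) _ f)
  (cong₂ _+_ (∑-map (true ∷_) (allSubsets n) f) (∑-map (false ∷_) (allSubsets n) f))

∑-allSubsets-++ : ∀ a b f →
  ∑ (allSubsets (a + b)) f ≡ ∑[ A ∈ allSubsets a ] ∑[ B ∈ allSubsets b ] f (A V.++ B)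
∑-allSubsets-++ zero    b f = sym (+-identityʳ _)
∑-allSubsets-++ (suc a) b f = begin
  ∑ (allSubsets (suc a + b)) f
    ≡⟨ ∑-allSubsets-suc (a + b) f ⟩
  ∑[ S ∈ allSubsets (a + b) ] f (true ∷ S) + ∑[ S ∈ allSubsets (a + b) ] f (false ∷ S)
    ≡⟨ cong₂ _+_ (∑-allSubsets-++ a b (f ∘ (true ∷_))) (∑-allSubsets-++ a b (f ∘ (false ∷_))) ⟩
  ∑[ A ∈ allSubsets a ] ∑[ B ∈ allSubsets b ] f (true ∷ A V.++ B) +
  ∑[ A ∈ allSubsets a ] ∑[ B ∈ allSubsets b ] f (false ∷ A V.++ B)
    ≡⟨ ∑-allSubsets-suc a _ ⟨
  ∑[ A ∈ allSubsets (suc a) ] ∑[ B ∈ allSubsets b ] f (A V.++ B) ∎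
  where open ≡-Reasoning

∑-allSubsets-1 : ∀ n → ∑[ S ∈ allSubsets n ] 1 ≡ 2 ^ n
∑-allSubsets-1 zero    = refl
∑-allSubsets-1 (suc n) = begin
  ∑[ S ∈ allSubsets (suc n) ] 1                      ≡⟨ ∑-allSubsets-suc n _ ⟩
  ∑[ S ∈ allSubsets n ] 1 + ∑[ S ∈ allSubsets n ] 1  ≡⟨ cong₂ _+_ (∑-allSubsets-1 n) (∑-allSubsets-1 n) ⟩
  2 ^ n + 2 ^ n                                      ≡⟨ cong (_+_ (2 ^ n)) (+-identityʳ (2 ^ n)) ⟨
  2 ^ suc n                                          ∎
  where open ≡-Reasoning

-- Subsets avoiding a difference

#containing : ℕ → ℕ → ℕ
#containing d n = ∑[ S ∈ allSubsets n ] 𝟙[ hasDiff S d ]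

#avoiding : ℕ → ℕ → ℕ
#avoiding d n = ∑[ S ∈ allSubsets n ] 𝟙[ not (hasDiff S d) ]

#containing+#avoiding : ∀ d n → #containing d n + #avoiding d n ≡ 2 ^ n
#containing+#avoiding d n = begin
  #containing d n + #avoiding d n
    ≡⟨ ∑-+ (allSubsets n) _ _ ⟨
  ∑[ S ∈ allSubsets n ] (𝟙[ hasDiff S d ] + 𝟙[ not (hasDiff S d) ])
    ≡⟨ ∑-cong (allSubsets n) (λ S → 𝟙+𝟙-not (hasDiff S d)) ⟩
  ∑[ S ∈ allSubsets n ] 1
    ≡⟨ ∑-allSubsets-1 n ⟩
  2 ^ n ∎
  where open ≡-Reasoning

#avoiding-zero : ∀ n → #avoiding 0 n ≡ 1
#avoiding-zero zero    = refl
#avoiding-zero (suc n) =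
  trans (∑-allSubsets-suc n _) (cong₂ _+_ (∑-zero (allSubsets n)) (#avoiding-zero n))

#containing-self : ∀ n → #containing n n ≡ 0
#containing-self n =
  trans (∑-cong (allSubsets n) (λ S → cong 𝟙[_] (hasDiff-≥ S n ≤-refl))) (∑-zero (allSubsets n))

#avoiding-≤ : ∀ d n → #avoiding d n ≤ 2 ^ n
#avoiding-≤ d n =
  ≤-trans (∑-mono (allSubsets n) λ S → 𝟙≤1 (not (hasDiff S d))) (≤-reflexive (∑-allSubsets-1 n))

#disjoint : ℕ → ℕ → ℕ
#disjoint a b = ∑[ A ∈ allSubsets a ] ∑[ B ∈ allSubsets b ] 𝟙[ not (meets A B) ]

#disjoint-zeroʳ : ∀ a → #disjoint a 0 ≡ 2 ^ a
#disjoint-zeroʳ a = trans (∑-cong (allSubsets a) (λ A → cong (λ b → 𝟙[ not b ] + 0) (meets-[]ʳ A)))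
                          (∑-allSubsets-1 a)

#disjoint-suc : ∀ a b → #disjoint (suc a) (suc b) ≡ 3 * #disjoint a b
#disjoint-suc a b = begin
  #disjoint (suc a) (suc b)
    ≡⟨ ∑-allSubsets-suc a _ ⟩
  ∑[ A ∈ allSubsets a ] ∑[ B′ ∈ allSubsets (suc b) ] 𝟙[ not (meets (true ∷ A) B′) ] +
  ∑[ A ∈ allSubsets a ] ∑[ B′ ∈ allSubsets (suc b) ] 𝟙[ not (meets (false ∷ A) B′) ]
    ≡⟨ cong₂ _+_ (∑-cong (allSubsets a) λ A →
                    trans (∑-allSubsets-suc b _) (cong (_+ N A) (∑-zero (allSubsets b))))
                 (∑-cong (allSubsets a) λ A → ∑-allSubsets-suc b _) ⟩
  ∑ (allSubsets a) N + ∑[ A ∈ allSubsets a ] (N A + N A)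
    ≡⟨ cong (_+_ (∑ (allSubsets a) N)) (∑-+ (allSubsets a) N N) ⟩
  #disjoint a b + (#disjoint a b + #disjoint a b)
    ≡⟨ cong (_+_ (#disjoint a b)) (cong (_+_ (#disjoint a b)) (+-identityʳ _)) ⟨
  3 * #disjoint a b ∎
  where
  open ≡-Reasoning
  N : Vec Bool a → ℕ
  N A = ∑[ B ∈ allSubsets b ] 𝟙[ not (meets A B) ]

#disjoint-+ : ∀ m k → #disjoint (m + k) m ≡ 3 ^ m * 2 ^ k
#disjoint-+ zero    k = trans (#disjoint-zeroʳ k) (sym (*-identityˡ _))
#disjoint-+ (suc m) k =
  trans (#disjoint-suc (m + k) m) (trans (cong (3 *_) (#disjoint-+ m k)) (sym (*-assoc 3 (3 ^ m) (2 ^ k))))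

#disjoint-diag : ∀ m → #disjoint m m ≡ 3 ^ m
#disjoint-diag zero    = refl
#disjoint-diag (suc m) = trans (#disjoint-suc m m) (cong (3 *_) (#disjoint-diag m))

#avoiding-++ : ∀ d m → #avoiding d (d + m) ≡
  ∑[ A ∈ allSubsets d ] ∑[ B ∈ allSubsets m ] 𝟙[ not (meets A B ∨ hasDiff B d) ]
#avoiding-++ d m = trans (∑-allSubsets-++ d m _)
  (∑-cong (allSubsets d) λ A → ∑-cong (allSubsets m) λ B → cong (𝟙[_] ∘ not) (hasDiff-++ A B))

#avoiding-exact : ∀ m k → #avoiding (m + k) ((m + k) + m) ≡ 3 ^ m * 2 ^ k
#avoiding-exact m k = begin
  #avoiding (m + k) ((m + k) + m)
    ≡⟨ #avoiding-++ (m + k) m ⟩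
  ∑[ A ∈ allSubsets (m + k) ] ∑[ B ∈ allSubsets m ] 𝟙[ not (meets A B ∨ hasDiff B (m + k)) ]
    ≡⟨ (∑-cong (allSubsets (m + k)) λ A → ∑-cong (allSubsets m) λ B →
         cong (λ b → 𝟙[ not (meets A B ∨ b) ]) (hasDiff-≥ B (m + k) (m≤m+n m k))) ⟩
  ∑[ A ∈ allSubsets (m + k) ] ∑[ B ∈ allSubsets m ] 𝟙[ not (meets A B ∨ false) ]
    ≡⟨ (∑-cong (allSubsets (m + k)) λ A → ∑-cong (allSubsets m) λ B →
         cong (𝟙[_] ∘ not) (∨-identityʳ (meets A B))) ⟩
  #disjoint (m + k) m
    ≡⟨ #disjoint-+ m k ⟩
  3 ^ m * 2 ^ k ∎
  where open ≡-Reasoning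

-- Cut {0,…,2d+m-1} into blocks A, B, C of lengths d, d, m and forget the constraint between B and C.
#avoiding-peel : ∀ d m → #avoiding d (d + (d + m)) ≤ 3 ^ d * #avoiding d m
#avoiding-peel d m = begin
  #avoiding d (d + (d + m))
    ≡⟨ #avoiding-++ d (d + m) ⟩
  ∑[ A ∈ Ss d ] ∑[ BC ∈ Ss (d + m) ] 𝟙[ not (meets A BC ∨ hasDiff BC d) ]
    ≡⟨ (∑-cong (Ss d) λ A → ∑-allSubsets-++ d m _) ⟩
  ∑[ A ∈ Ss d ] ∑[ B ∈ Ss d ] ∑[ C ∈ Ss m ] 𝟙[ not (meets A (B V.++ C) ∨ hasDiff (B V.++ C) d) ]
    ≡⟨ (∑-cong (Ss d) λ A → ∑-cong (Ss d) λ B → ∑-cong (Ss m) λ C →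
         cong₂ (λ u v → 𝟙[ not (u ∨ v) ]) (meets-++ʳ A B C) (hasDiff-++ B C)) ⟩
  ∑[ A ∈ Ss d ] ∑[ B ∈ Ss d ] ∑[ C ∈ Ss m ] 𝟙[ not (meets A B ∨ (meets B C ∨ hasDiff C d)) ]
    ≤⟨ (∑-mono (Ss d) λ A → ∑-mono (Ss d) λ B → ∑-mono (Ss m) λ C →
         𝟙-not-∨-≤ (meets A B) (meets B C) (hasDiff C d)) ⟩
  ∑[ A ∈ Ss d ] ∑[ B ∈ Ss d ] ∑[ C ∈ Ss m ] (𝟙[ not (meets A B) ] * 𝟙[ not (hasDiff C d) ])
    ≡⟨ (∑-cong (Ss d) λ A → ∑-cong (Ss d) λ B → ∑-*ˡ (Ss m) 𝟙[ not (meets A B) ] _) ⟩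
  ∑[ A ∈ Ss d ] ∑[ B ∈ Ss d ] (𝟙[ not (meets A B) ] * #avoiding d m)
    ≡⟨ trans (∑-cong (Ss d) λ A → ∑-*ʳ (Ss d) _ _) (∑-*ʳ (Ss d) _ _) ⟩
  #disjoint d d * #avoiding d m
    ≡⟨ cong (_* #avoiding d m) (#disjoint-diag d) ⟩
  3 ^ d * #avoiding d m ∎
  where
  open ≤-Reasoning
  Ss : (n : ℕ) → List (Subset n)
  Ss = allSubsets

#avoiding-cube-base : ∀ d m → m < d + d → (3 ^ d * #avoiding d m) ^ 3 ≤ 6 ^ (d + (d + m))
#avoiding-cube-base d m m<2d with m ≤? d
... | yes m≤d = ≤-trans (^-monoˡ-≤ 3 (*-monoʳ-≤ (3 ^ d) (#avoiding-≤ d m))) (cube-3^*2^≤6^ m≤d)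
... | no  m≰d with m≤n⇒∃[o]m+o≡n (≰⇒≥ m≰d)
...   | j , refl with m≤n⇒∃[o]m+o≡n (<⇒≤ (+-cancelˡ-< d j d m<2d))
...     | k , refl = begin
  (3 ^ (j + k) * #avoiding (j + k) ((j + k) + j)) ^ 3
    ≡⟨ cong (λ t → (3 ^ (j + k) * t) ^ 3) (#avoiding-exact j k) ⟩
  (3 ^ (j + k) * (3 ^ j * 2 ^ k)) ^ 3
    ≡⟨ cong (_^ 3) (trans (sym (*-assoc (3 ^ (j + k)) (3 ^ j) (2 ^ k)))
                          (cong (_* 2 ^ k) (sym (^-distribˡ-+-* 3 (j + k) j)))) ⟩
  (3 ^ ((j + k) + j) * 2 ^ k) ^ 3
    ≤⟨ cube-3^*2^≤6^ (≤-trans (m≤n+m k j) (m≤m+n (j + k) j)) ⟩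
  6 ^ (((j + k) + j) + (((j + k) + j) + k))
    ≡⟨ cong (6 ^_) (exponents j k) ⟩
  6 ^ ((j + k) + ((j + k) + ((j + k) + j))) ∎
  where
  open ≤-Reasoning
  exponents : ∀ j k → ((j + k) + j) + (((j + k) + j) + k) ≡ (j + k) + ((j + k) + ((j + k) + j))
  exponents = solve-∀

#avoiding-cube : ∀ {d n} → 1 ≤ d → d + d ≤ n → #avoiding d n ^ 3 ≤ 6 ^ n
#avoiding-cube {d} 1≤d 2d≤n with m≤n⇒∃[o]m+o≡n 2d≤n
... | m , refl = subst P (sym (+-assoc d d m)) (<-rec P′ bound m)
  where
  P : ℕ → Set
  P n = #avoiding d n ^ 3 ≤ 6 ^ n

  P′ : ℕ → Set
  P′ m = P (d + (d + m))

  bound : ∀ m → WfRec _<_ P′ m → P′ m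
  bound m rec = ≤-trans (^-monoˡ-≤ 3 (#avoiding-peel d m)) (peeled (d + d ≤? m))
    where
    peeled : Dec (d + d ≤ m) → (3 ^ d * #avoiding d m) ^ 3 ≤ 6 ^ (d + (d + m))
    peeled (no  2d≰m) = #avoiding-cube-base d m (≰⇒> 2d≰m)
    peeled (yes 2d≤m) with m≤n⇒∃[o]m+o≡n 2d≤m
    ... | m′ , refl = cube-3^*-≤6^ d (d + d + m′) _
                        (subst P (sym (+-assoc d d m′)) (rec (m<n+m m′ (+-mono-≤ 1≤d z≤n))))

-- The sum of |S - S|

at-lookup : ∀ {n} (S : Vec Bool n) (i : Fin n) → at S (toℕ i) ≡ V.lookup S i
at-lookup (b ∷ S) Fin.zero    = refl
at-lookup (b ∷ S) (Fin.suc i) = at-lookup S i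

∈-elems⁻ : ∀ {n} (S : Subset n) {a} → a ∈ elems S → T (at S a)
∈-elems⁻ S a∈S with ∈-map⁻ toℕ a∈S
... | i , i∈ , refl =
  from T-≡ (trans (at-lookup S i) ([]=⇒lookup (proj₂ (∈-filter⁻ (Subset._∈? S) {xs = L.allFin _} i∈))))

∈-elems⁺ : ∀ {n} (S : Subset n) {a} → T (at S a) → a ∈ elems S
∈-elems⁺ {n} S {a} a∈S = subst (_∈ elems S) (toℕ-fromℕ< a<n)
  (∈-map⁺ toℕ (∈-filter⁺ (Subset._∈? S) (∈-allFin i) (lookup⇒[]= i S S[i]≡true)))
  where
  a<n : a < n
  a<n = at-< S a a∈S
  i : Fin n
  i = fromℕ< a<n
  S[i]≡true : V.lookup S i ≡ true
  S[i]≡true = trans (sym (at-lookup S i)) (trans (cong (at S) (toℕ-fromℕ< a<n)) (to T-≡ a∈S))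

∈-diffList⁻ : ∀ {n} (S : Subset n) {z} → z ∈ diffList S →
  ∃[ a ] ∃[ b ] T (at S a) × T (at S b) × z ≡ a ⊖ b
∈-diffList⁻ S z∈ with find (∈-concatMap⁻ (λ a → L.map (a ⊖_) (elems S)) z∈)
... | a , a∈S , z∈a-S with ∈-map⁻ (a ⊖_) z∈a-S
...   | b , b∈S , z≡a-b = a , b , ∈-elems⁻ S a∈S , ∈-elems⁻ S b∈S , z≡a-b

∈-diffList⁺ : ∀ {n} (S : Subset n) {a b} → T (at S a) → T (at S b) → a ⊖ b ∈ diffList S
∈-diffList⁺ S a∈S b∈S = ∈-concatMap⁺ (λ a → L.map (a ⊖_) (elems S))
  (lose (∈-elems⁺ S a∈S) (∈-map⁺ (_ ⊖_) (∈-elems⁺ S b∈S)))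

+∈diffList⇔ : ∀ {n} (S : Subset n) d → + d ∈ diffList S ⇔ T (hasDiff S d)
+∈diffList⇔ S d = mk⇔ to′ from′
  where
  to′ : + d ∈ diffList S → T (hasDiff S d)
  to′ d∈ with ∈-diffList⁻ S d∈
  ... | a , b , a∈S , b∈S , d≡a-b with ⊖-view a b
  ...   | inj₁ (_ , refl , a-b≡+d′) with trans d≡a-b a-b≡+d′
  ...     | refl = hasDiff-complete S d (b , b∈S , a∈S)
  to′ d∈ | a , b , _ , _ , d≡a-b | inj₂ (_ , _ , a-b≡-d′) with trans d≡a-b a-b≡-d′
  ...     | ()
  from′ : T (hasDiff S d) → + d ∈ diffList S
  from′ p with hasDiff-sound S d p
  ... | j , j∈S , j+d∈S = subst (_∈ diffList S) ([m+n]⊖m≡+n j d) (∈-diffList⁺ S j+d∈S j∈S)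

-∈diffList⇔ : ∀ {n} (S : Subset n) d → -[1+ d ] ∈ diffList S ⇔ T (hasDiff S (suc d))
-∈diffList⇔ S d = mk⇔ to′ from′
  where
  to′ : -[1+ d ] ∈ diffList S → T (hasDiff S (suc d))
  to′ d∈ with ∈-diffList⁻ S d∈
  ... | a , b , a∈S , b∈S , d≡a-b with ⊖-view a b
  ...   | inj₂ (_ , refl , a-b≡-d′) with trans d≡a-b a-b≡-d′
  ...     | refl = hasDiff-complete S (suc d) (a , a∈S , b∈S)
  to′ d∈ | a , b , _ , _ , d≡a-b | inj₁ (_ , _ , a-b≡+d′) with trans d≡a-b a-b≡+d′
  ...     | ()
  from′ : T (hasDiff S (suc d)) → -[1+ d ] ∈ diffList S
  from′ p with hasDiff-sound S (suc d) p
  ... | j , j∈S , j+1+d∈S = subst (_∈ diffList S) (m⊖[m+1+n]≡-[1+n] j d) (∈-diffList⁺ S j∈S j+1+d∈S)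

candidateDiffs : ℕ → List ℤ
candidateDiffs n = L.map +_ (L.upTo n) ++ L.map -[1+_] (L.upTo n)

candidateDiffs-unique : ∀ n → Unique (candidateDiffs n)
candidateDiffs-unique n =
  Unique.++⁺ (Unique.map⁺ ℤ.+-injective (Unique.upTo⁺ n))
             (Unique.map⁺ ℤ.-[1+-injective (Unique.upTo⁺ n))
             disjoint
  where
  disjoint : ∀ {z} → ¬ (z ∈ L.map +_ (L.upTo n) × z ∈ L.map -[1+_] (L.upTo n))
  disjoint (z∈₁ , z∈₂) with ∈-map⁻ +_ z∈₁ | ∈-map⁻ -[1+_] z∈₂
  ... | _ , _ , refl | _ , _ , ()

diffList⊆candidateDiffs : ∀ {n} (S : Subset n) {z} → z ∈ diffList S → z ∈ candidateDiffs n
diffList⊆candidateDiffs {n} S z∈ with ∈-diffList⁻ S z∈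
... | a , b , a∈S , b∈S , refl with ⊖-view a b
...   | inj₁ (d , refl , a-b≡+d) = subst (_∈ candidateDiffs n) (sym a-b≡+d)
        (∈-++⁺ˡ (∈-map⁺ +_ (∈-upTo⁺ (≤-<-trans (m≤n+m d b) (at-< S _ a∈S)))))
...   | inj₂ (d , refl , a-b≡-d) = subst (_∈ candidateDiffs n) (sym a-b≡-d)
        (∈-++⁺ʳ (L.map +_ (L.upTo n)) (∈-map⁺ -[1+_] (∈-upTo⁺ (<-trans d<a+1+d (at-< S _ b∈S)))))
  where
  d<a+1+d : d < a + suc d
  d<a+1+d = ≤-<-trans (m≤n+m d a) (+-monoʳ-< a (n<1+n d))

diffCard-≡ : ∀ {n} (S : Subset n) →
  diffCard S ≡ ∑[ d < n ] 𝟙[ hasDiff S d ] + ∑[ d < n ] 𝟙[ hasDiff S (suc d) ]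
diffCard-≡ {n} S = begin
  diffCard S
    ≡⟨ length-deduplicate ℤ._≟_ (candidateDiffs n) xs (candidateDiffs-unique n) (diffList⊆candidateDiffs S) ⟩
  ∑[ z ∈ candidateDiffs n ] 𝟙[ does (z ∈? xs) ]
    ≡⟨ ∑-++ (L.map +_ (L.upTo n)) _ _ ⟩
  ∑[ z ∈ L.map +_ (L.upTo n) ] 𝟙[ does (z ∈? xs) ] + ∑[ z ∈ L.map -[1+_] (L.upTo n) ] 𝟙[ does (z ∈? xs) ]
    ≡⟨ cong₂ _+_ (trans (∑-map +_ (L.upTo n) _) (∑-applyUpTo (λ d → d) n _))
                 (trans (∑-map -[1+_] (L.upTo n) _) (∑-applyUpTo (λ d → d) n _)) ⟩
  ∑[ d < n ] 𝟙[ does (+ d ∈? xs) ] + ∑[ d < n ] 𝟙[ does (-[1+ d ] ∈? xs) ]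
    ≡⟨ cong₂ _+_
         (∑<-cong n λ d _ → cong 𝟙[_] (does-⇔ (+∈diffList⇔ S d) (+ d ∈? xs) (T? (hasDiff S d))))
         (∑<-cong n λ d _ → cong 𝟙[_] (does-⇔ (-∈diffList⇔ S d) (-[1+ d ] ∈? xs) (T? (hasDiff S (suc d))))) ⟩
  ∑[ d < n ] 𝟙[ hasDiff S d ] + ∑[ d < n ] 𝟙[ hasDiff S (suc d) ] ∎
  where
  open ≡-Reasoning
  open import Data.List.Membership.DecPropositional ℤ._≟_ using (_∈?_)
  xs : List ℤ
  xs = diffList S

totalDiff-≡ : ∀ n → totalDiff n ≡ ∑[ d < n ] #containing d n + ∑[ d < n ] #containing (suc d) n
totalDiff-≡ n = begin
  totalDiff n
    ≡⟨ ∑-cong (allSubsets n) diffCard-≡ ⟩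
  ∑[ S ∈ allSubsets n ] (∑[ d < n ] 𝟙[ hasDiff S d ] + ∑[ d < n ] 𝟙[ hasDiff S (suc d) ])
    ≡⟨ ∑-+ (allSubsets n) _ _ ⟩
  ∑[ S ∈ allSubsets n ] ∑[ d < n ] 𝟙[ hasDiff S d ] + ∑[ S ∈ allSubsets n ] ∑[ d < n ] 𝟙[ hasDiff S (suc d) ]
    ≡⟨ cong₂ _+_ (∑-∑<-comm (allSubsets n) n λ S d → 𝟙[ hasDiff S d ])
                 (∑-∑<-comm (allSubsets n) n λ S d → 𝟙[ hasDiff S (suc d) ]) ⟩
  ∑[ d < n ] #containing d n + ∑[ d < n ] #containing (suc d) n ∎
  where open ≡-Reasoning

totalDiff-identity : ∀ n → totalDiff n + 2 * (∑[ d < n ] #avoiding d n) + 2 ^ n ≡ 2 * (n * 2 ^ n) + 1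
totalDiff-identity n = begin
  totalDiff n + 2 * M + 2 ^ n     ≡⟨ cong₂ (λ t p → t + 2 * M + p) (totalDiff-≡ n) (sym H₀+1≡2^n) ⟩
  (P + Q) + 2 * M + (H₀ + 1)      ≡⟨ regroup P Q M H₀ ⟩
  P + (H₀ + Q) + 2 * M + 1        ≡⟨ cong (λ p → P + p + 2 * M + 1) H₀+Q≡P ⟩
  P + P + 2 * M + 1               ≡⟨ double P M ⟩
  2 * (P + M) + 1                 ≡⟨ cong (λ t → 2 * t + 1) P+M≡n2^n ⟩
  2 * (n * 2 ^ n) + 1             ∎
  where
  open ≡-Reasoning
  P : ℕ
  P = ∑[ d < n ] #containing d n
  Q : ℕ
  Q = ∑[ d < n ] #containing (suc d) n
  M : ℕ
  M = ∑[ d < n ] #avoiding d n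
  H₀ : ℕ
  H₀ = #containing 0 n

  H₀+1≡2^n : H₀ + 1 ≡ 2 ^ n
  H₀+1≡2^n = trans (cong (_+_ H₀) (sym (#avoiding-zero n))) (#containing+#avoiding 0 n)

  H₀+Q≡P : H₀ + Q ≡ P
  H₀+Q≡P = trans (∑<-suc n (λ d → #containing d n))
                 (trans (cong (_+_ P) (#containing-self n)) (+-identityʳ P))

  P+M≡n2^n : P + M ≡ n * 2 ^ n
  P+M≡n2^n = begin
    P + M                          ≡⟨ ∑<-+ n _ _ ⟨
    ∑[ d < n ] (#containing d n + #avoiding d n) ≡⟨ ∑<-cong n (λ d _ → #containing+#avoiding d n) ⟩
    ∑[ d < n ] 2 ^ n               ≡⟨ ∑<-const n (2 ^ n) ⟩
    n * 2 ^ n                      ∎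

  regroup : ∀ p q m h → (p + q) + 2 * m + (h + 1) ≡ p + (h + q) + 2 * m + 1
  regroup = solve-∀

  double : ∀ p m → p + p + 2 * m + 1 ≡ 2 * (p + m) + 1
  double = solve-∀

#avoiding-large : ∀ K e i → i < K → #avoiding ((K + e) + i) ((K + e) + K) ≡ 2 ^ e * (3 ^ (K ∸ i) * 4 ^ i)
#avoiding-large K e i i<K with m≤n⇒∃[o]m+o≡n i<K
... | r , refl = begin
  #avoiding ((suc i + r + e) + i) ((suc i + r + e) + (suc i + r))
    ≡⟨ cong₂ #avoiding (index-≡ i r e) (size-≡ i r e) ⟩
  #avoiding (suc r + (e + (i + i))) ((suc r + (e + (i + i))) + suc r)
    ≡⟨ #avoiding-exact (suc r) (e + (i + i)) ⟩
  3 ^ suc r * 2 ^ (e + (i + i))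
    ≡⟨ cong (3 ^ suc r *_) (trans (^-distribˡ-+-* 2 e (i + i)) (cong (2 ^ e *_) 2^[i+i]≡4^i)) ⟩
  3 ^ suc r * (2 ^ e * 4 ^ i)
    ≡⟨ *-left-comm (3 ^ suc r) (2 ^ e) (4 ^ i) ⟩
  2 ^ e * (3 ^ suc r * 4 ^ i)
    ≡⟨ cong (λ k → 2 ^ e * (3 ^ k * 4 ^ i)) (sym (m+n∸m≡n i (suc r))) ⟩
  2 ^ e * (3 ^ (i + suc r ∸ i) * 4 ^ i)
    ≡⟨ cong (λ k → 2 ^ e * (3 ^ (k ∸ i) * 4 ^ i)) (+-suc i r) ⟩
  2 ^ e * (3 ^ (suc i + r ∸ i) * 4 ^ i) ∎
  where
  open ≡-Reasoning
  index-≡ : ∀ i r e → (suc i + r + e) + i ≡ suc r + (e + (i + i))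
  index-≡ = solve-∀
  size-≡ : ∀ i r e → (suc i + r + e) + (suc i + r) ≡ (suc r + (e + (i + i))) + suc r
  size-≡ = solve-∀
  2^[i+i]≡4^i : 2 ^ (i + i) ≡ 4 ^ i
  2^[i+i]≡4^i = trans (^-distribˡ-+-* 2 i i) (sym (^-distribʳ-* 2 2 i))

∑#avoiding-large : ∀ K e →
  ∑[ i < K ] #avoiding ((K + e) + i) ((K + e) + K) + 2 ^ e * 3 ^ suc K ≡ 3 * 2 ^ ((K + e) + K)
∑#avoiding-large K e = begin
  ∑[ i < K ] #avoiding ((K + e) + i) ((K + e) + K) + 2 ^ e * 3 ^ suc K
    ≡⟨ cong (λ s → s + 2 ^ e * 3 ^ suc K) (trans (∑<-cong K (#avoiding-large K e)) (∑<-*ˡ K (2 ^ e) _)) ⟩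
  2 ^ e * G + 2 ^ e * 3 ^ suc K
    ≡⟨ *-distribˡ-+ (2 ^ e) G (3 ^ suc K) ⟨
  2 ^ e * (G + 3 ^ suc K)
    ≡⟨ cong (2 ^ e *_) (∑-geometric 3 K) ⟩
  2 ^ e * (3 * (2 * 2) ^ K)
    ≡⟨ cong (λ t → 2 ^ e * (3 * t)) (^-distribʳ-* 2 2 K) ⟩
  2 ^ e * (3 * (2 ^ K * 2 ^ K))
    ≡⟨ regroup (2 ^ e) (2 ^ K) ⟩
  3 * (2 ^ K * 2 ^ e * 2 ^ K)
    ≡⟨ cong (λ t → 3 * (t * 2 ^ K)) (^-distribˡ-+-* 2 K e) ⟨
  3 * (2 ^ (K + e) * 2 ^ K)
    ≡⟨ cong (3 *_) (^-distribˡ-+-* 2 (K + e) K) ⟨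
  3 * 2 ^ ((K + e) + K) ∎
  where
  open ≡-Reasoning
  G : ℕ
  G = ∑[ i < K ] (3 ^ (K ∸ i) * 4 ^ i)
  regroup : ∀ x y → x * (3 * (y * y)) ≡ 3 * (y * x * y)
  regroup = solve-∀

totalDiff-identity-halves : ∀ K e → let n = (K + e) + K in
  2 * (∑[ d < K + e ] #avoiding d n) + (totalDiff n + 2 ^ n * 7)
    ≡ 2 ^ n * (2 * n) + (1 + 2 * (2 ^ e * 3 ^ suc K))
totalDiff-identity-halves K e = begin
  2 * B + (D + p * 7)                ≡⟨ regroup₁ B D p ⟩
  2 * B + D + p + 2 * (3 * p)        ≡⟨ cong (λ y → 2 * B + D + p + 2 * y) (∑#avoiding-large K e) ⟨
  2 * B + D + p + 2 * (U + X)        ≡⟨ regroup₂ B D p U X ⟩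
  D + 2 * (B + U) + p + 2 * X        ≡⟨ cong (λ m → D + 2 * m + p + 2 * X) (∑<-+-split (K + e) K _) ⟨
  D + 2 * M + p + 2 * X              ≡⟨ cong (λ t → t + 2 * X) (totalDiff-identity n) ⟩
  2 * (n * p) + 1 + 2 * X            ≡⟨ regroup₃ n p X ⟩
  p * (2 * n) + (1 + 2 * X)          ∎
  where
  open ≡-Reasoning
  n : ℕ
  n = (K + e) + K
  p : ℕ
  p = 2 ^ n
  D : ℕ
  D = totalDiff n
  M : ℕ
  M = ∑[ d < n ] #avoiding d n
  B : ℕ
  B = ∑[ d < K + e ] #avoiding d n
  U : ℕ
  U = ∑[ i < K ] #avoiding ((K + e) + i) n
  X : ℕ
  X = 2 ^ e * 3 ^ suc K
  regroup₁ : ∀ b t p → 2 * b + (t + p * 7) ≡ 2 * b + t + p + 2 * (3 * p)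
  regroup₁ = solve-∀
  regroup₂ : ∀ b t p u x → 2 * b + t + p + 2 * (u + x) ≡ t + 2 * (b + u) + p + 2 * x
  regroup₂ = solve-∀
  regroup₃ : ∀ n p x → 2 * (n * p) + 1 + 2 * x ≡ p * (2 * n) + (1 + 2 * x)
  regroup₃ = solve-∀

totalDiff-deviation : ∀ K e → let n = (K + e) + K in
  + totalDiff n -ℤ (+ (2 ^ n)) *ℤ (+ (2 * n) -ℤ + 7)
    ≡ (1 + 2 * (2 ^ e * 3 ^ suc K)) ⊖ (2 * (∑[ d < K + e ] #avoiding d n))
totalDiff-deviation K e =
  [+t]-[+p]*[+m-+c]≡x⊖b (totalDiff n) (2 ^ n) (2 * n) 7 (2 * B) (1 + 2 * (2 ^ e * 3 ^ suc K))
    (totalDiff-identity-halves K e)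
  where
  n : ℕ
  n = (K + e) + K
  B : ℕ
  B = ∑[ d < K + e ] #avoiding d n

-- The estimate

halve : ∀ n → ∃[ K ] ∃[ e ] e ≤ 1 × (K + e) + K ≡ n
halve zero    = 0 , 0 , z≤n , refl
halve (suc n) with halve n
... | K , 0 , _ , refl = K , 1 , ≤-refl , even K
  where
  even : ∀ K → (K + 1) + K ≡ suc ((K + 0) + K)
  even = solve-∀
... | K , 1 , _ , refl = suc K , 0 , z≤n , odd K
  where
  odd : ∀ K → (suc K + 0) + suc K ≡ suc ((K + 1) + K)
  odd = solve-∀
... | _ , suc (suc _) , s≤s () , _

remainder-·∛ : ∀ K e → e ≤ 1 → let n = (K + e) + K in
  1 + 2 * (2 ^ e * 3 ^ suc K) + 2 * (∑[ d < K + e ] #avoiding d n) ≤ 1 + 2 * 6 + 2 * (K + e) ·∛ 6 ^ n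
remainder-·∛ K e e≤1 = ·∛-+ (·∛-+ (·∛-1 {a = 1} 1≤6^n) (·∛-*ˡ 2 X≤)) (·∛-*ˡ 2 (·∛-∑< (K + e) _ small-d))
  where
  n : ℕ
  n = (K + e) + K

  K+K≤n : K + K ≤ n
  K+K≤n = +-monoˡ-≤ K (m≤m+n K e)

  1≤6^n : 1 ≤ 6 ^ n
  1≤6^n = m^n>0 6 n

  X≤ : 2 ^ e * 3 ^ suc K ≤ 6 ·∛ 6 ^ n
  X≤ = ·∛-monoˡ (≤-trans (*-monoˡ-≤ (3 ^ suc K) (^-monoʳ-≤ 2 e≤1)) (≤-reflexive (sym (*-assoc 2 3 (3 ^ K)))))
                (·∛-*ˡ 6 (·∛-1 {a = 3 ^ K} (≤-trans (cube-3^≤6^ K) (^-monoʳ-≤ 6 K+K≤n))))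

  small-d : ∀ d → d < K + e → #avoiding d n ≤ 1 ·∛ 6 ^ n
  small-d zero    _       = ·∛-1 (subst (λ a → a ^ 3 ≤ 6 ^ n) (sym (#avoiding-zero n)) 1≤6^n)
  small-d (suc d) d<K+e =
    ·∛-1 (#avoiding-cube (s≤s z≤n) (≤-trans (+-mono-≤ 1+d≤K 1+d≤K) K+K≤n))
    where
    1+d≤K : suc d ≤ K
    1+d≤K = ≤-pred (≤-trans d<K+e (≤-trans (+-monoʳ-≤ K e≤1) (≤-reflexive (+-comm K 1))))

theorem18 : ∃[ C ] ((n : ℕ) → 1 ≤ n →
    ∣ + totalDiff n -ℤ (+ (2 ^ n)) *ℤ (+ (2 * n) -ℤ + 7) ∣ ^ 3 ≤ C * (n ^ 3 * 6 ^ n))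
theorem18 = 15 ^ 3 , bound
  where
  bound : (n : ℕ) → 1 ≤ n →
    ∣ + totalDiff n -ℤ (+ (2 ^ n)) *ℤ (+ (2 * n) -ℤ + 7) ∣ ^ 3 ≤ 15 ^ 3 * (n ^ 3 * 6 ^ n)
  bound n 1≤n with halve n
  ... | K , e , e≤1 , refl = begin
    ∣ + totalDiff n -ℤ (+ (2 ^ n)) *ℤ (+ (2 * n) -ℤ + 7) ∣ ^ 3
      ≡⟨ cong (λ z → ∣ z ∣ ^ 3) (totalDiff-deviation K e) ⟩
    ∣ (1 + 2 * X) ⊖ (2 * B) ∣ ^ 3
      ≤⟨ ^-monoˡ-≤ 3 (∣m⊖n∣≤m+n (1 + 2 * X) (2 * B)) ⟩
    (1 + 2 * X + 2 * B) ^ 3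
      ≤⟨ cubed (·∛-monoʳ 13+2[K+e]≤15n (remainder-·∛ K e e≤1)) ⟩
    (15 * n) ^ 3 * 6 ^ n
      ≡⟨ trans (cong (_* 6 ^ n) (^-distribʳ-* 15 n 3)) (*-assoc (15 ^ 3) (n ^ 3) (6 ^ n)) ⟩
    15 ^ 3 * (n ^ 3 * 6 ^ n) ∎
    where
    open ≤-Reasoning
    X : ℕ
    X = 2 ^ e * 3 ^ suc K
    B : ℕ
    B = ∑[ d < K + e ] #avoiding d n
    13+2[K+e]≤15n : 13 + 2 * (K + e) ≤ 15 * n
    13+2[K+e]≤15n = ≤-trans (+-mono-≤ (*-monoʳ-≤ 13 1≤n) (*-monoʳ-≤ 2 (m≤m+n (K + e) K)))
                             (≤-reflexive (sym (*-distribʳ-+ n 13 2)))
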